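{- Let $\mathcal{B}$ be a finite relational structure with domain $B$, let $b,b'\in B$ be distinct, and suppose the shop $\forall_b\exists_{b'}$ is a she of $\mathcal{B}$. Let $\varphi(u,\mathbf{v})$ be a formula of $\{\exists,\forall,\wedge,\vee\}$-FO, where $\mathbf{v}$ has arity $k$. Then for all $c\in B$ and all $\mathbf{x}=(x_1,\dots,x_k)\in\{b,b'\}^k$: if $\mathcal{B}\models\varphi(b,\mathbf{x})$ then $\mathcal{B}\models\varphi(c,\mathbf{x})$, and if $\mathcal{B}\models\varphi(c,\mathbf{x})$ then $\mathcal{B}\models\varphi(b',\mathbf{x})$.
   Context: $\{\exists,\forall,\wedge,\vee\}$-FO is the set of first-order formulas over the signature of $\mathcal{B}$ built from relational atoms using only $\wedge,\vee,\exists,\forall$ (no equality, no negation). A shop on $B$ is a map $f:B\to\mathfrak{P}(B)\setminus\{\emptyset\}$ with every $y\in B$ in some $f(x)$; a she of $\mathcal{B}$ is a shop $f$ such that for each relation $R$ of $\mathcal{B}$, $\mathcal{B}\models R(x_1,\dots,x_i)$ implies $\mathcal{B}\models R(y_1,\dots,y_i)$ for all $y_j\in f(x_j)$. The shop $\forall_b\exists_{b'}$ is defined by $\forall_b\exists_{b'}(b)=B$ and $\forall_b\exists_{b'}(x)=\{b'\}$ for $x\neq b$. -}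

module Defs where

open import Data.Nat using (ℕ; suc)
open import Data.Fin using (Fin)
open import Data.Product using (_×_; ∃)
open import Data.Sum using (_⊎_)
open import Relation.Nullary using (¬_)
open import Relation.Binary.PropositionalEquality using (_≡_)
open import Data.Vec.Functional using (Vector; _∷_)
open import Function using (_∘_)

record Signature : Set where
  field
    nsym  : ℕ
    arity : Fin nsym → ℕ
open Signature public

record Structure (σ : Signature) : Set₁ where
  field
    size : ℕ
    Rel  : (R : Fin (nsym σ)) → Vector (Fin size) (arity σ R) → Set
open Structure public

Dom : {σ : Signature} → Structure σ → Set
Dom 𝓑 = Fin (size 𝓑)

-- {∃,∀,∧,∨}-FO formulas over σ with (at most) v free variables (de Bruijn style):
-- relational atoms, ∧, ∨, ∃, ∀; no equality, no negation.
data Formula (σ : Signature) : ℕ → Set where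
  atom : ∀ {v} (R : Fin (nsym σ)) → Vector (Fin v) (arity σ R) → Formula σ v
  _∧'_ : ∀ {v} → Formula σ v → Formula σ v → Formula σ v
  _∨'_ : ∀ {v} → Formula σ v → Formula σ v → Formula σ v
  ∃'   : ∀ {v} → Formula σ (suc v) → Formula σ v
  ∀'   : ∀ {v} → Formula σ (suc v) → Formula σ v

-- Satisfaction 𝓑 ⊨ φ[ρ], where ρ assigns domain elements to the free variables
-- (the bound variable of ∃'/∀' is variable 0 of the body).
_⊨_[_] : ∀ {σ v} (𝓑 : Structure σ) → Formula σ v → Vector (Dom 𝓑) v → Set
𝓑 ⊨ atom R ts [ ρ ] = Rel 𝓑 R (ρ ∘ ts)
𝓑 ⊨ φ ∧' ψ [ ρ ] = (𝓑 ⊨ φ [ ρ ]) × (𝓑 ⊨ ψ [ ρ ])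
𝓑 ⊨ φ ∨' ψ [ ρ ] = (𝓑 ⊨ φ [ ρ ]) ⊎ (𝓑 ⊨ ψ [ ρ ])
𝓑 ⊨ ∃' φ [ ρ ] = ∃ λ a → 𝓑 ⊨ φ [ a ∷ ρ ]
𝓑 ⊨ ∀' φ [ ρ ] = ∀ a → 𝓑 ⊨ φ [ a ∷ ρ ]

-- A map f : B → 𝔓(B), represented by its membership relation: y ∈ f x  ↔  f x y.
Shop-map : Set → Set₁
Shop-map B = B → B → Set

IsShop : {B : Set} → Shop-map B → Set
IsShop {B} f = (∀ x → ∃ λ y → f x y) × (∀ y → ∃ λ x → f x y)

IsShe : ∀ {σ} (𝓑 : Structure σ) → Shop-map (Dom 𝓑) → Set
IsShe {σ} 𝓑 f =
  IsShop f ×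
  (∀ (R : Fin (nsym σ)) (xs ys : Vector (Dom 𝓑) (arity σ R)) →
     Rel 𝓑 R xs → (∀ j → f (xs j) (ys j)) → Rel 𝓑 R ys)

-- The shop ∀_b ∃_{b'}: f(b) = B, and f(x) = {b'} for x ≠ b.
∀∃ : {B : Set} → B → B → Shop-map B
∀∃ b b' x y = (x ≡ b) ⊎ ((¬ x ≡ b) × (y ≡ b'))

-- A she f preserves every {∃,∀,∧,∨}-formula along f: if each variable is moved
-- from x to some y ∈ f(x), truth is kept. Atoms are preserved by definition of a
-- she, ∧ and ∨ trivially, ∃ because every f(a) is nonempty, and ∀ because every
-- element lies in some f(x). For f = ∀_b∃_{b'} the points b and b' are fixed
-- (b ∈ f(b), and b' ≠ b gives f(b') = {b'}), while b may be sent to any c and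
-- any c to b'.
module Submission where

open import Defs
open import Data.Nat using (ℕ; suc)
open import Data.Fin using (Fin; zero; suc; _≟_)
open import Data.Product using (_×_; _,_; proj₁; proj₂)
open import Data.Sum using (_⊎_; inj₁; inj₂)
open import Relation.Nullary using (¬_; yes; no)
open import Relation.Binary.PropositionalEquality using (_≡_; refl; sym; trans)
open import Data.Vec.Functional using (Vector; _∷_)
open import Data.Vec.Functional.Relation.Binary.Pointwise using (Pointwise)

module _ {B : Set} (f : Shop-map B) where

  ∷⁺ : ∀ {n x y} {xs ys : Vector B n} →
       f x y → Pointwise f xs ys → Pointwise f (x ∷ xs) (y ∷ ys)
  ∷⁺ fxy fxs zero    = fxy
  ∷⁺ fxy fxs (suc i) = fxs i

she-preserves-⊨ : ∀ {σ} (𝓑 : Structure σ) {f : Shop-map (Dom 𝓑)} → IsShe 𝓑 f →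
  ∀ {v} (φ : Formula σ v) {ρ ρ' : Vector (Dom 𝓑) v} →
  Pointwise f ρ ρ' → 𝓑 ⊨ φ [ ρ ] → 𝓑 ⊨ φ [ ρ' ]
she-preserves-⊨ 𝓑 she (atom R ts) ρfρ' h = proj₂ she R _ _ h (λ j → ρfρ' (ts j))
she-preserves-⊨ 𝓑 she (φ ∧' ψ) ρfρ' (hφ , hψ) =
  she-preserves-⊨ 𝓑 she φ ρfρ' hφ , she-preserves-⊨ 𝓑 she ψ ρfρ' hψ
she-preserves-⊨ 𝓑 she (φ ∨' ψ) ρfρ' (inj₁ hφ) = inj₁ (she-preserves-⊨ 𝓑 she φ ρfρ' hφ)
she-preserves-⊨ 𝓑 she (φ ∨' ψ) ρfρ' (inj₂ hψ) = inj₂ (she-preserves-⊨ 𝓑 she ψ ρfρ' hψ)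
she-preserves-⊨ 𝓑 {f} she (∃' φ) ρfρ' (a , h) with proj₁ (proj₁ she) a
... | y , fay = y , she-preserves-⊨ 𝓑 she φ (∷⁺ f fay ρfρ') h
she-preserves-⊨ 𝓑 {f} she (∀' φ) ρfρ' h a' with proj₂ (proj₁ she) a'
... | x , fxa' = she-preserves-⊨ 𝓑 she φ (∷⁺ f fxa' ρfρ') (h x)

module _ {B : Set} {b b' : B} where

  ∀∃-from-source : ∀ y → ∀∃ b b' b y
  ∀∃-from-source y = inj₁ refl

  ∀∃-fixes-target : ¬ b ≡ b' → ∀∃ b b' b' b'
  ∀∃-fixes-target b≢b' = inj₂ ((λ b'≡b → b≢b' (sym b'≡b)) , refl)

  ∀∃-refl-on-source-target : ¬ b ≡ b' → ∀ {x} → (x ≡ b) ⊎ (x ≡ b') → ∀∃ b b' x x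
  ∀∃-refl-on-source-target b≢b' (inj₁ refl) = ∀∃-from-source b
  ∀∃-refl-on-source-target b≢b' (inj₂ refl) = ∀∃-fixes-target b≢b'

∀∃-to-target : ∀ {n} {b b' : Fin n} x → ∀∃ b b' x b'
∀∃-to-target {b = b} x with x ≟ b
... | yes x≡b = inj₁ x≡b
... | no  x≢b = inj₂ (x≢b , refl)

lemma3p3 : ∀ {σ : Signature} (𝓑 : Structure σ) (b b' : Dom 𝓑) → ¬ b ≡ b' →
    IsShe 𝓑 (∀∃ b b') →
    ∀ {k : ℕ} (φ : Formula σ (suc k)) (c : Dom 𝓑) (x : Vector (Dom 𝓑) k) →
    (∀ i → (x i ≡ b) ⊎ (x i ≡ b')) →
    ((𝓑 ⊨ φ [ b ∷ x ] → 𝓑 ⊨ φ [ c ∷ x ]) × (𝓑 ⊨ φ [ c ∷ x ] → 𝓑 ⊨ φ [ b' ∷ x ]))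
lemma3p3 𝓑 b b' b≢b' she φ c x x∈bb' =
    she-preserves-⊨ 𝓑 she φ (∷⁺ f (∀∃-from-source c) x-fixed)
  , she-preserves-⊨ 𝓑 she φ (∷⁺ f (∀∃-to-target c) x-fixed)
  where
  f = ∀∃ b b'
  x-fixed : Pointwise f x x
  x-fixed i = ∀∃-refl-on-source-target b≢b' (x∈bb' i)
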